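{- Let $\mathcal{T}$ be an even $X$-tree, let $\pi$ be a partition of $X$ displayed by $\mathcal{T}$, and let $F$ be a subset of edges of $\mathcal{T}$ that displays $\pi$. Then $\mathcal{T}/F$ is an even $X$-tree.
   Context: $X$ is a finite set with $|X|\ge 2$. A partition of $X$ is a set of $t\ge 2$ pairwise disjoint non-empty subsets (parts) whose union is $X$. A weak $X$-tree $(T;\phi)$ is a tree $T$ with $\phi:X\to V(T)$ such that every leaf lies in $\phi(X)$; it is an even $X$-tree if $d_T(\phi(x),\phi(y))$ (path length) is even for all $x,y\in X$. For an edge $e$, $\sigma_e=A|(X-A)$ with $A=\phi^{ -1}(W)$, $W$ the vertex set of a component of $T-e$. A subset $F$ of edges displays $\pi$ if there is a bijection $\xi:\pi\to F$ with $\sigma_{\xi(A)}=A|(X-A)$ for all $A\in\pi$; $\mathcal{T}$ displays $\pi$ if such an $F$ exists. $\mathcal{T}/F$ is the weak $X$-tree obtained by contracting every edge of $F$, where each contracted vertex is labelled by the union of the labels of the identified vertices (i.e. elements of $X$ mapped to any of the identified vertices are mapped to the new vertex). -}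

module Defs where

open import Data.Nat using (ℕ; zero; suc; _+_; _≤_)
open import Data.Nat.Divisibility using (_∣_)
open import Data.Fin using (Fin; _≟_)
open import Data.Fin.Subset using (Subset; _∈_; _∉_)
open import Data.List using (List; []; _∷_; _++_; [_]; length; filter; allFin)
open import Data.List.Relation.Unary.All using (All)
open import Data.List.Relation.Unary.Unique.Propositional using (Unique)
open import Data.Product using (Σ; ∃; ∃-syntax; _×_; _,_; proj₁; proj₂)
open import Data.Sum using (_⊎_)
open import Relation.Binary.PropositionalEquality using (_≡_; _≢_)
open import Function.Bundles using (_⇔_)
open import Function.Definitions using (Injective; Surjective)

-- Finite (multi)graphs with labelling by X = Fin n.
-- Vertices are Fin m, edges are Fin k, each edge has two ends.

record LGraph (n : ℕ) : Set where
  field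
    m    : ℕ
    k    : ℕ
    ends : Fin k → Fin m × Fin m
    φ    : Fin n → Fin m
open LGraph public

module _ {n : ℕ} (G : LGraph n) where

  Step : Fin (k G) → Fin (m G) → Fin (m G) → Set
  Step e u w = (ends G e ≡ (u , w)) ⊎ (ends G e ≡ (w , u))

  data Walk : Fin (m G) → Fin (m G) → Set where
    nil  : ∀ {u} → Walk u u
    cons : ∀ {u w v} (e : Fin (k G)) → Step e u w → Walk w v → Walk u v

  wedges : ∀ {u v} → Walk u v → List (Fin (k G))
  wedges nil = []
  wedges (cons e _ w) = e ∷ wedges w

  wstarts : ∀ {u v} → Walk u v → List (Fin (m G))
  wstarts nil = []
  wstarts (cons {u} e _ w) = u ∷ wstarts w

  wlength : ∀ {u v} → Walk u v → ℕ
  wlength w = length (wedges w)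

  IsPath : ∀ {u v} → Walk u v → Set
  IsPath {u} {v} w = Unique (wstarts w ++ [ v ])

  IsCycle : ∀ {u} → Walk u u → Set
  IsCycle w = (1 ≤ wlength w) × Unique (wedges w) × Unique (wstarts w)

  Connected : Set
  Connected = ∀ u v → Walk u v

  Acyclic : Set
  Acyclic = ∀ u (w : Walk u u) → IsCycle w → Data.Empty.⊥
    where import Data.Empty

  IsTree : Set
  IsTree = Connected × Acyclic

  -- degree (a loop counts twice)
  degree : Fin (m G) → ℕ
  degree v = length (filter (λ e → proj₁ (ends G e) ≟ v) (allFin (k G)))
           + length (filter (λ e → proj₂ (ends G e) ≟ v) (allFin (k G)))

  IsLeaf : Fin (m G) → Set
  IsLeaf v = degree v ≡ 1

  IsWeakXTree : Set
  IsWeakXTree = IsTree × (∀ v → IsLeaf v → ∃[ x ] φ G x ≡ v)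

  -- even X-tree: path distance between any two labelled vertices is even
  -- (in a tree the path is unique, so we require every such path be even)
  IsEvenXTree : Set
  IsEvenXTree = IsWeakXTree
              × (∀ x y (p : Walk (φ G x) (φ G y)) → IsPath p → 2 ∣ wlength p)

  -- a is in the component of T - e containing u
  ReachAvoiding : Fin (k G) → Fin (m G) → Fin (m G) → Set
  ReachAvoiding e u a = Σ (Walk u a) λ w → All (_≢ e) (wedges w)

  -- sigma_e = A | (X - A): A is phi^{-1}(W) for W one of the two components
  -- of T - e (given as a predicate on X)
  SplitIs : Fin (k G) → (Fin n → Set) → Set
  SplitIs e A =
      (∀ x → A x ⇔ ReachAvoiding e (proj₁ (ends G e)) (φ G x))
    ⊎ (∀ x → A x ⇔ ReachAvoiding e (proj₂ (ends G e)) (φ G x))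

  ReachWithin : Subset (k G) → Fin (m G) → Fin (m G) → Set
  ReachWithin F u v = Σ (Walk u v) λ w → All (_∈ F) (wedges w)

-- Partitions of X = Fin n into t ≥ 2 non-empty parts, encoded by a
-- surjective part-label map p : Fin n → Fin t; the parts are the fibres.

record Partition (n : ℕ) : Set where
  field
    t       : ℕ
    2≤t     : 2 ≤ t
    part    : Fin n → Fin t
    nonempty : Surjective _≡_ _≡_ part
open Partition public

Part : ∀ {n} (π : Partition n) → Fin (t π) → Fin n → Set
Part π i x = part π x ≡ i

-- F displays π : a bijection ξ : π → F with σ_{ξ(A)} = A | (X - A)
Displays : ∀ {n} (T : LGraph n) (π : Partition n) (F : Subset (k T)) → Set
Displays T π F =
  Σ (Fin (t π) → Fin (k T)) λ ξ →
      Injective _≡_ _≡_ ξ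
    × (∀ e → e ∈ F ⇔ (∃[ i ] ξ i ≡ e))
    × (∀ i → SplitIs T (ξ i) (Part π i))

DisplaysPartition : ∀ {n} (T : LGraph n) (π : Partition n) → Set
DisplaysPartition T π = Σ (Subset (k T)) λ F → Displays T π F

-- T' is (a copy of) T / F : there is a surjection h of vertices whose
-- fibres are exactly the components of (V(T), F), a bijection κ from the
-- edges of T' onto the edges of T not in F, compatible with endpoints,
-- and labels are mapped by h.
IsContraction : ∀ {n} (T : LGraph n) (F : Subset (k T)) (T' : LGraph n) → Set
IsContraction T F T' =
  Σ (Fin (m T) → Fin (m T')) λ h →
  Σ (Fin (k T') → Fin (k T)) λ κ →
      Surjective _≡_ _≡_ h
    × (∀ u v → (h u ≡ h v) ⇔ ReachWithin T F u v)
    × Injective _≡_ _≡_ κ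
    × (∀ e → e ∉ F ⇔ (∃[ j ] κ j ≡ e))
    × (∀ j → (ends T' j ≡ (h (proj₁ (ends T (κ j))) , h (proj₂ (ends T (κ j)))))
           ⊎ (ends T' j ≡ (h (proj₂ (ends T (κ j))) , h (proj₁ (ends T (κ j))))))
    × (∀ x → φ T' x ≡ h (φ T x))

-- For a walk W in
-- T and an edge e, crossings e W is the parity of the number of traversals of
-- e.  In an acyclic graph the two sides of e (vertices reachable from either
-- end without using e) are disjoint, and a walk changes side exactly when it
-- traverses e; in a tree this makes crossings e W depend only on the ends of W,
-- hence (summing over all edges) so does the parity of the length of W.
--
-- For T / F: walks of T project to walks of T / F (connectivity), and every
-- walk of T / F lifts to a walk of T whose edges outside F have the parity of
-- its length (acyclicity, by lifting a cycle; evenness, since F = ξ(π) and a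
-- walk between labels x, y crosses ξ i oddly iff exactly one of x, y is in part
-- i, so the F-edges of the lift have even total).  Finally an unlabelled leaf
-- of T / F would force a leaf of T in its fibre, which is labelled.
module Submission where

open import Defs
open import Data.Nat using (ℕ; zero; suc; _≤_; s≤s; z≤n; parity) renaming (_+_ to _+ℕ_)
open import Data.Nat.Properties using (suc-injective)
open import Data.Nat.Divisibility using (_∣_; divides; ∣-refl; ∣m∣n⇒∣m+n)
open import Data.Parity.Base using (Parity; 0ℙ; 1ℙ; _⁻¹; _+_)
open import Data.Parity.Properties
  using (+-identityʳ; +-assoc; +-comm; *-zeroʳ; +-homo-+; *-homo-*; p≢p⁻¹; +-0-commutativeMonoid)
  renaming (_≟_ to _≟ℙ_)
open import Algebra.Properties.CommutativeMonoid.Sum +-0-commutativeMonoid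
  using (sum; sum-syntax; ∑-distrib-+; sum-cong-≗; sum-remove; sum-replicate-zero)
open import Algebra.Properties.CommutativeSemigroup
  (Data.Parity.Properties.+-commutativeSemigroup) using (interchange)
open import Data.Fin using (Fin; zero; suc; _≟_; punchIn)
open import Data.Fin.Properties using (punchInᵢ≢i; any?)
open import Data.Fin.Subset using (Subset) renaming (_∈_ to _∈ₛ_; _∉_ to _∉ₛ_)
open import Data.Fin.Subset.Properties using () renaming (_∈?_ to _∈ₛ?_)
open import Data.List using (List; []; _∷_; _++_; [_]; length; filter; allFin)
open import Data.List.Properties using (filter-none)
open import Data.List.Relation.Unary.Unique.Propositional.Properties using (filter⁺; allFin⁺)
open import Data.List.Membership.Propositional using (_∈_)
open import Data.List.Membership.Propositional.Properties
  using (∈-++⁺ʳ; ∈-++⁻; ∈-filter⁺; ∈-filter⁻; ∈-allFin)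
open import Data.List.Relation.Unary.Any using (here; there)
open import Data.List.Relation.Unary.All using (All; []; _∷_)
import Data.List.Relation.Unary.All as All
import Data.List.Relation.Unary.All.Properties as AllP
open import Data.List.Relation.Unary.All.Properties using (¬Any⇒All¬)
open import Data.List.Relation.Unary.AllPairs using ([]; _∷_)
open import Data.List.Relation.Unary.Unique.Propositional using (Unique)
open import Data.List.Relation.Binary.Subset.Propositional using (_⊆_)
open import Data.Sum using (_⊎_; inj₁; inj₂)
open import Data.Bool using (if_then_else_)
open import Data.Product using (Σ; ∃-syntax; _×_; _,_; proj₁; proj₂; swap)
open import Data.Product.Properties using (,-injective)
open import Relation.Nullary using (¬_; does; yes; no; contradiction)
open import Relation.Unary using (Decidable)
open import Relation.Nullary.Decidable using (dec-true; dec-false)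
open import Relation.Binary.PropositionalEquality
  using (_≡_; _≢_; refl; sym; trans; cong; cong₂; subst; subst₂; ≢-sym; module ≡-Reasoning)
open import Function using (_∘_; id)
open import Function.Definitions using (Injective; Surjective)
open import Function.Bundles using (_⇔_; mk⇔; Equivalence)

open ≡-Reasoning

even⇒parity≡0ℙ : ∀ {n} → 2 ∣ n → parity n ≡ 0ℙ
even⇒parity≡0ℙ (divides q refl) = trans (*-homo-* q 2) (*-zeroʳ (parity q))

parity≡0ℙ⇒even : ∀ n → parity n ≡ 0ℙ → 2 ∣ n
parity≡0ℙ⇒even zero          _  = divides 0 refl
parity≡0ℙ⇒even (suc zero)    ()
parity≡0ℙ⇒even (suc (suc n)) p0 = ∣m∣n⇒∣m+n ∣-refl (parity≡0ℙ⇒even n p0)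

≢⇒opposite : ∀ {p q : Parity} → p ≢ q → p ≡ q ⁻¹
≢⇒opposite {0ℙ} {0ℙ} p≢q = contradiction refl p≢q
≢⇒opposite {0ℙ} {1ℙ} _   = refl
≢⇒opposite {1ℙ} {0ℙ} _   = refl
≢⇒opposite {1ℙ} {1ℙ} p≢q = contradiction refl p≢q

solve-+ : ∀ {p c q : Parity} → p + c ≡ q → c ≡ p + q
solve-+ {0ℙ}      refl = refl
solve-+ {1ℙ} {0ℙ} refl = refl
solve-+ {1ℙ} {1ℙ} refl = refl

cancel-common : ∀ s a b → (s + a ⁻¹) + (s + b ⁻¹) ≡ a + b
cancel-common 0ℙ 0ℙ 0ℙ = refl
cancel-common 0ℙ 0ℙ 1ℙ = refl
cancel-common 0ℙ 1ℙ 0ℙ = refl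
cancel-common 0ℙ 1ℙ 1ℙ = refl
cancel-common 1ℙ 0ℙ 0ℙ = refl
cancel-common 1ℙ 0ℙ 1ℙ = refl
cancel-common 1ℙ 1ℙ 0ℙ = refl
cancel-common 1ℙ 1ℙ 1ℙ = refl

⁻¹-shift : ∀ p c → p ⁻¹ + c ≡ p + c ⁻¹
⁻¹-shift 0ℙ c  = refl
⁻¹-shift 1ℙ 0ℙ = refl
⁻¹-shift 1ℙ 1ℙ = refl

δ : ∀ {k} → Fin k → Fin k → Parity
δ a b = if does (a ≟ b) then 1ℙ else 0ℙ

δ-same : ∀ {k} (a : Fin k) → δ a a ≡ 1ℙ
δ-same a = cong (if_then 1ℙ else 0ℙ) (dec-true (a ≟ a) refl)

δ-diff : ∀ {k} {a b : Fin k} → a ≢ b → δ a b ≡ 0ℙ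
δ-diff {a = a} {b} a≢b = cong (if_then 1ℙ else 0ℙ) (dec-false (a ≟ b) a≢b)

∑-zero : ∀ {t} (f : Fin t → Parity) → (∀ i → f i ≡ 0ℙ) → ∑[ i < t ] f i ≡ 0ℙ
∑-zero {t} f f≡0 = trans (sum-cong-≗ f≡0) (sum-replicate-zero t)

∑-single : ∀ {t} (f : Fin t → Parity) (i₀ : Fin t) →
           (∀ i → i ≢ i₀ → f i ≡ 0ℙ) → ∑[ i < t ] f i ≡ f i₀
∑-single {suc t} f i₀ f≡0 = begin
  sum f                         ≡⟨ sum-remove {i = i₀} f ⟩
  f i₀ + sum (f ∘ punchIn i₀)
    ≡⟨ cong (f i₀ +_) (∑-zero _ (λ j → f≡0 _ (punchInᵢ≢i i₀ j))) ⟩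
  f i₀ + 0ℙ                     ≡⟨ +-identityʳ (f i₀) ⟩
  f i₀                          ∎

∑δ-image : ∀ {t k} {ξ : Fin t → Fin k} → Injective _≡_ _≡_ ξ →
           ∀ {e} → (∃[ i ] ξ i ≡ e) → ∑[ i < t ] δ (ξ i) e ≡ 1ℙ
∑δ-image {ξ = ξ} ξ-inj (i₀ , refl) =
  trans (∑-single _ i₀ (λ i i≢i₀ → δ-diff (i≢i₀ ∘ ξ-inj))) (δ-same (ξ i₀))

∑δ-outside : ∀ {t k} {ξ : Fin t → Fin k} {e} →
             ¬ (∃[ i ] ξ i ≡ e) → ∑[ i < t ] δ (ξ i) e ≡ 0ℙ
∑δ-outside e∉ξ = ∑-zero _ (λ i → δ-diff (λ ξi≡e → e∉ξ (i , ξi≡e)))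

weight : ∀ {k} → (Fin k → Parity) → List (Fin k) → Parity
weight w []      = 0ℙ
weight w (e ∷ L) = w e + weight w L

weight-cong : ∀ {k} {w w′ : Fin k → Parity} → (∀ e → w e ≡ w′ e) →
              ∀ L → weight w L ≡ weight w′ L
weight-cong w≗w′ []      = refl
weight-cong w≗w′ (e ∷ L) = cong₂ _+_ (w≗w′ e) (weight-cong w≗w′ L)

weight-++ : ∀ {k} (w : Fin k → Parity) L L′ →
            weight w (L ++ L′) ≡ weight w L + weight w L′
weight-++ w []      L′ = refl
weight-++ w (e ∷ L) L′ =
  trans (cong (w e +_) (weight-++ w L L′)) (sym (+-assoc (w e) _ _))

weight-+ : ∀ {k} (w w′ : Fin k → Parity) L →
           weight (λ e → w e + w′ e) L ≡ weight w L + weight w′ L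
weight-+ w w′ []      = refl
weight-+ w w′ (e ∷ L) =
  trans (cong ((w e + w′ e) +_) (weight-+ w w′ L))
        (interchange (w e) (w′ e) (weight w L) (weight w′ L))

weight-∑ : ∀ {t k} (w : Fin t → Fin k → Parity) L →
           weight (λ e → ∑[ i < t ] w i e) L ≡ ∑[ i < t ] weight (w i) L
weight-∑ {t} w []      = sym (∑-zero {t} _ (λ _ → refl))
weight-∑ w (e ∷ L) = begin
  sum (λ i → w i e) + weight (λ e → sum (λ i → w i e)) L
    ≡⟨ cong (sum (λ i → w i e) +_) (weight-∑ w L) ⟩
  sum (λ i → w i e) + sum (λ i → weight (w i) L)
    ≡⟨ sym (∑-distrib-+ (λ i → w i e) (λ i → weight (w i) L)) ⟩
  sum (λ i → w i e + weight (w i) L) ∎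

weight-ones : ∀ {k} (L : List (Fin k)) → weight (λ _ → 1ℙ) L ≡ parity (length L)
weight-ones []      = refl
weight-ones (e ∷ L) = trans (cong (1ℙ +_) (weight-ones L)) (sym (+-homo-+ 1 (length L)))

crossings : ∀ {k} → Fin k → List (Fin k) → Parity
crossings e = weight (δ e)

odd-crossings⇒∈ : ∀ {k} (e : Fin k) L → crossings e L ≡ 1ℙ → e ∈ L
odd-crossings⇒∈ e []      ()
odd-crossings⇒∈ e (x ∷ L) odd with e ≟ x
... | yes refl = here refl
... | no  _    = there (odd-crossings⇒∈ e L odd)

parity-length : ∀ {k} (L : List (Fin k)) →
                parity (length L) ≡ ∑[ e < k ] crossings e L
parity-length {k} L = begin
  parity (length L)                    ≡⟨ sym (weight-ones L) ⟩
  weight (λ _ → 1ℙ) L                  ≡⟨ weight-cong (λ x → sym (∑δ-image id (x , refl))) L ⟩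
  weight (λ x → ∑[ e < k ] δ e x) L    ≡⟨ weight-∑ δ L ⟩
  ∑[ e < k ] crossings e L             ∎

unique-snoc : ∀ {A : Set} {x : A} xs → Unique (xs ++ [ x ]) → Unique (x ∷ xs)
unique-snoc []       _             = [] ∷ []
unique-snoc {x = x} (y ∷ xs) (y∉ ∷ uniq) with unique-snoc xs uniq
... | x∉xs ∷ uniq′ = (x≢y ∷ x∉xs) ∷ (AllP.++⁻ˡ xs y∉ ∷ uniq′)
  where
  x≢y : x ≢ y
  x≢y x≡y = All.lookup y∉ (∈-++⁺ʳ xs (here refl)) (sym x≡y)

endpoint : ∀ {A : Set} → Parity → A × A → A
endpoint 0ℙ = proj₁
endpoint 1ℙ = proj₂

module Walks {n : ℕ} (G : LGraph n) where

  open import Data.List.Membership.DecPropositional (_≟_ {n = m G}) using (_∈?_)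

  visits : ∀ {u v} → Walk G u v → List (Fin (m G))
  visits {v = v} W = wstarts G W ++ [ v ]

  start∈visits : ∀ {u v} (W : Walk G u v) → u ∈ visits W
  start∈visits nil          = here refl
  start∈visits (cons _ _ _) = here refl

  step-sym : ∀ {e u w} → Step G e u w → Step G e w u
  step-sym (inj₁ eq) = inj₂ eq
  step-sym (inj₂ eq) = inj₁ eq

  step-from : ∀ p e → Step G e (endpoint p (ends G e)) (endpoint (p ⁻¹) (ends G e))
  step-from 0ℙ e = inj₁ refl
  step-from 1ℙ e = inj₂ refl

  step-endpoints : ∀ {e u w} → Step G e u w →
                   ∃[ p ] endpoint p (ends G e) ≡ u × endpoint (p ⁻¹) (ends G e) ≡ w
  step-endpoints (inj₁ eq) = 0ℙ , cong proj₁ eq , cong proj₂ eq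
  step-endpoints (inj₂ eq) = 1ℙ , cong proj₂ eq , cong proj₁ eq

  endpoint-of-step : ∀ {e u w} → Step G e u w → ∀ q →
                     endpoint q (ends G e) ≡ u ⊎ endpoint q (ends G e) ≡ w
  endpoint-of-step (inj₁ eq) 0ℙ = inj₁ (cong proj₁ eq)
  endpoint-of-step (inj₁ eq) 1ℙ = inj₂ (cong proj₂ eq)
  endpoint-of-step (inj₂ eq) 0ℙ = inj₂ (cong proj₁ eq)
  endpoint-of-step (inj₂ eq) 1ℙ = inj₁ (cong proj₂ eq)

  infixr 5 _++w_
  _++w_ : ∀ {u v x} → Walk G u v → Walk G v x → Walk G u x
  nil          ++w W′ = W′
  cons e s W   ++w W′ = cons e s (W ++w W′)

  wedges-++w : ∀ {u v x} (W : Walk G u v) (W′ : Walk G v x) →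
               wedges G (W ++w W′) ≡ wedges G W ++ wedges G W′
  wedges-++w nil          W′ = refl
  wedges-++w (cons e s W) W′ = cong (e ∷_) (wedges-++w W W′)

  reverse : ∀ {u v} → Walk G u v → Walk G v u
  reverse nil          = nil
  reverse (cons e s W) = reverse W ++w cons e (step-sym s) nil

  reverse-⊆ : ∀ {u v} (W : Walk G u v) → wedges G (reverse W) ⊆ wedges G W
  reverse-⊆ (cons e s W) e′∈ rewrite wedges-++w (reverse W) (cons e (step-sym s) nil)
    with ∈-++⁻ (wedges G (reverse W)) e′∈
  ... | inj₁ e′∈W      = there (reverse-⊆ W e′∈W)
  ... | inj₂ (here eq) = here eq

  reach-trans : ∀ {e u v x} → ReachAvoiding G e u v → ReachAvoiding G e v x →
                ReachAvoiding G e u x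
  reach-trans (W , W-avoids) (W′ , W′-avoids) =
    W ++w W′ , subst (All _) (sym (wedges-++w W W′)) (AllP.++⁺ W-avoids W′-avoids)

  reach-sym : ∀ {e u v} → ReachAvoiding G e u v → ReachAvoiding G e v u
  reach-sym (W , W-avoids) = reverse W , AllP.anti-mono (reverse-⊆ W) W-avoids

  reach-step : ∀ {e f x u w} → f ≢ e → Step G f u w →
               ReachAvoiding G e x u → ReachAvoiding G e x w
  reach-step f≢e s r = reach-trans r (cons _ s nil , f≢e ∷ [])

  suffix : ∀ {u v x} (W : Walk G u v) → x ∈ visits W →
           Σ (Walk G x v) λ S → wedges G S ⊆ wedges G W × (IsPath G W → IsPath G S)
  suffix nil          (here refl) = nil , id , id
  suffix (cons e s W) (here refl) = cons e s W , id , id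
  suffix (cons e s W) (there x∈W) with suffix W x∈W
  ... | S , S⊆W , S-path = S , there ∘ S⊆W , λ { (_ ∷ W-path) → S-path W-path }

  shortcut : ∀ {u v} (W : Walk G u v) →
             Σ (Walk G u v) λ P → IsPath G P × wedges G P ⊆ wedges G W
  shortcut nil = nil , [] ∷ [] , id
  shortcut {u} (cons e s W) with shortcut W
  ... | P , P-path , P⊆W with u ∈? visits P
  ...   | yes u∈P = let (S , S⊆P , S-path) = suffix P u∈P
                    in S , S-path P-path , there ∘ P⊆W ∘ S⊆P
  ...   | no  u∉P = cons e s P , ¬Any⇒All¬ _ u∉P ∷ P-path
                  , λ { (here eq) → here eq ; (there e′∈P) → there (P⊆W e′∈P) }

  edge-in-walk : ∀ {e u v} (W : Walk G u v) → e ∈ wedges G W →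
                 ∃[ x ] ∃[ y ] Step G e x y × x ∈ visits W × y ∈ visits W
  edge-in-walk (cons e s W) (here refl) = _ , _ , s , here refl , there (start∈visits W)
  edge-in-walk (cons f s W) (there e∈W) with edge-in-walk W e∈W
  ... | x , y , st , x∈W , y∈W = x , y , st , there x∈W , there y∈W

  same-edge-endpoints : ∀ {e u w x y} → Step G e u w → Step G e x y → u ≡ x ⊎ u ≡ y
  same-edge-endpoints s st with step-endpoints s
  ... | p , refl , _ = endpoint-of-step st p

  path-edges-unique : ∀ {u v} (P : Walk G u v) → IsPath G P → Unique (wedges G P)
  path-edges-unique nil _ = []
  path-edges-unique (cons e s P) (u∉P ∷ P-path) =
    ¬Any⇒All¬ _ e∉P ∷ path-edges-unique P P-path
    where
    e∉P : ¬ (e ∈ wedges G P)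
    e∉P e∈P with edge-in-walk P e∈P
    ... | x , y , st , x∈P , y∈P with same-edge-endpoints s st
    ...   | inj₁ refl = All.lookup u∉P x∈P refl
    ...   | inj₂ refl = All.lookup u∉P y∈P refl

  -- In an acyclic graph the ends of an edge are not joined by a walk avoiding
  -- that edge: the edge followed by such a walk, shortened to a path, would be
  -- a cycle.
  no-return : Acyclic G → ∀ {e a b} → Step G e a b → ¬ ReachAvoiding G e a b
  no-return acyclic {e} {a} st (W , W-avoids) with shortcut (reverse W)
  ... | P , P-path , P⊆ =
    acyclic a (cons e st P) (s≤s z≤n , edges-unique , unique-snoc (wstarts G P) P-path)
    where
    edges-unique : Unique (e ∷ wedges G P)
    edges-unique = All.map ≢-sym (AllP.anti-mono (reverse-⊆ W ∘ P⊆) W-avoids)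
                 ∷ path-edges-unique P P-path

  reach-endpoint : ∀ {e u v} (W : Walk G u v) → e ∈ wedges G W →
                   ∃[ p ] Σ (Walk G u (endpoint p (ends G e))) λ P → wedges G P ⊆ wedges G W
  reach-endpoint (cons e s W) (here refl) with step-endpoints s
  ... | p , refl , _ = p , nil , λ ()
  reach-endpoint (cons f s W) (there e∈W) with reach-endpoint W e∈W
  ... | p , P , P⊆W = p , cons f s P
                    , λ { (here eq) → here eq ; (there e′∈P) → there (P⊆W e′∈P) }

-- The two sides of an edge e in an acyclic graph: side p consists of the
-- vertices reachable from endpoint p of e without using e.  Walking along a
-- walk one changes side exactly when traversing e, so the parity of the number
-- of traversals of e is determined by the sides of the ends of the walk.
module Sides {n : ℕ} (G : LGraph n) (acyclic : Acyclic G) (e : Fin (k G)) where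

  open Walks G

  -- (A record, so that the side p can be inferred from a proof of OnSide p v.)
  record OnSide (p : Parity) (v : Fin (m G)) : Set where
    constructor on-side
    field reach : ReachAvoiding G e (endpoint p (ends G e)) v

  own-side : ∀ p → OnSide p (endpoint p (ends G e))
  own-side p = on-side (nil , [])

  edge-within-side : ∀ {f p q} → f ≢ e → OnSide p (endpoint q (ends G f)) →
                     ∀ r → OnSide p (endpoint r (ends G f))
  edge-within-side {f} {p} {q} f≢e on-p r with r ≟ℙ q
  ... | yes refl = on-p
  ... | no  r≢q  = subst (λ r′ → OnSide p (endpoint r′ (ends G f))) (sym (≢⇒opposite r≢q))
                         (on-side (reach-step f≢e (step-from q f) (OnSide.reach on-p)))

  sides-disjoint : ∀ {p q v} → OnSide p v → OnSide q v → p ≡ q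
  sides-disjoint {0ℙ} {0ℙ} _ _ = refl
  sides-disjoint {1ℙ} {1ℙ} _ _ = refl
  sides-disjoint {0ℙ} {1ℙ} (on-side r) (on-side r′) =
    contradiction (reach-trans r (reach-sym r′)) (no-return acyclic (step-from 0ℙ e))
  sides-disjoint {1ℙ} {0ℙ} (on-side r) (on-side r′) =
    contradiction (reach-trans r (reach-sym r′)) (no-return acyclic (step-from 1ℙ e))

  cross-edge : ∀ {p u w} → OnSide p u → Step G e u w → OnSide (p ⁻¹) w
  cross-edge {p} on-p s with step-endpoints s
  ... | q , refl , refl with sides-disjoint {p} {q} on-p (own-side q)
  ...   | refl = own-side (p ⁻¹)

  transport : ∀ {p u v} → OnSide p u → (W : Walk G u v) →
              OnSide (p + crossings e (wedges G W)) v
  transport {p} on-p nil = subst (λ q → OnSide q _) (sym (+-identityʳ p)) on-p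
  transport {p} on-p (cons f s W) with e ≟ f
  ... | yes refl = subst (λ q → OnSide q _) (⁻¹-shift p _) (transport (cross-edge on-p s) W)
  ... | no  e≢f  = transport {p} (on-side (reach-step (≢-sym e≢f) s (OnSide.reach on-p))) W

  split-side : ∀ {A} → SplitIs G e A → ∃[ s ] (∀ x → A x ⇔ OnSide s (φ G x))
  split-side (inj₁ sp) =
    0ℙ , λ x → mk⇔ (on-side ∘ Equivalence.to (sp x)) (Equivalence.from (sp x) ∘ OnSide.reach)
  split-side (inj₂ sp) =
    1ℙ , λ x → mk⇔ (on-side ∘ Equivalence.to (sp x)) (Equivalence.from (sp x) ∘ OnSide.reach)

  side-of : Connected G → ∀ v → ∃[ p ] OnSide p v
  side-of connected v = _ , transport (own-side 0ℙ) (connected _ v)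

  crossings-by-sides : ∀ {p q u v} → OnSide p u → OnSide q v → (W : Walk G u v) →
                       crossings e (wedges G W) ≡ p + q
  crossings-by-sides {p} on-p on-q W = solve-+ {p} (sides-disjoint (transport on-p W) on-q)

crossings-invariant : ∀ {n} (G : LGraph n) → IsTree G → ∀ e {u v} (W W′ : Walk G u v) →
                      crossings e (wedges G W) ≡ crossings e (wedges G W′)
crossings-invariant G (connected , acyclic) e {u} {v} W W′ =
  trans (crossings-by-sides on-u on-v W) (sym (crossings-by-sides on-u on-v W′))
  where
  open Sides G acyclic e
  on-u = proj₂ (side-of connected u)
  on-v = proj₂ (side-of connected v)

length-parity-invariant : ∀ {n} (G : LGraph n) → IsTree G → ∀ {u v} (W W′ : Walk G u v) →
                          parity (wlength G W) ≡ parity (wlength G W′)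
length-parity-invariant G tree W W′ = begin
  parity (wlength G W)                     ≡⟨ parity-length (wedges G W) ⟩
  ∑[ e < k G ] crossings e (wedges G W)    ≡⟨ sum-cong-≗ (λ e → crossings-invariant G tree e W W′) ⟩
  ∑[ e < k G ] crossings e (wedges G W′)   ≡⟨ sym (parity-length (wedges G W′)) ⟩
  parity (wlength G W′)                    ∎

-- A split A | (X − A) induced by an edge e of a tree puts the labels in A on
-- one side s of e and all other labels on the opposite side.
split-crossings : ∀ {n} (G : LGraph n) (tree : IsTree G) (π : Partition n) {e i} →
                  SplitIs G e (Part π i) →
                  ∀ {x y} (W : Walk G (φ G x) (φ G y)) →
                  crossings e (wedges G W) ≡ δ i (part π x) + δ i (part π y)
split-crossings G (connected , acyclic) π {e} {i} split {x} {y} W = begin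
  crossings e (wedges G W)
    ≡⟨ crossings-by-sides (label-side x) (label-side y) W ⟩
  (s + δ i (part π x) ⁻¹) + (s + δ i (part π y) ⁻¹)
    ≡⟨ cancel-common s _ _ ⟩
  δ i (part π x) + δ i (part π y) ∎
  where
  open Sides G acyclic e

  s = proj₁ (split-side split)

  label-side : ∀ x → OnSide (s + δ i (part π x) ⁻¹) (φ G x)
  label-side x with i ≟ part π x
  ... | yes i≡px = subst (λ q → OnSide q _) (sym (+-identityʳ s))
                         (Equivalence.to (proj₂ (split-side split) x) (sym i≡px))
  ... | no  i≢px with side-of connected (φ G x)
  ...   | p , on-p = subst (λ q → OnSide q _) (trans (≢⇒opposite p≢s) (+-comm 1ℙ s)) on-p
    where
    p≢s : p ≢ s
    p≢s refl = i≢px (sym (Equivalence.from (proj₂ (split-side split) x) on-p))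

module Counting {A : Set} {P : A → Set} (P? : Decidable P) where

  none-counted : ∀ {xs x} → length (filter P? xs) ≡ 0 → x ∈ xs → ¬ P x
  none-counted {xs} c≡0 x∈xs px with filter P? xs | ∈-filter⁺ P? x∈xs px
  none-counted () _ _ | _ ∷ _ | _

  none-counted⁻ : ∀ {xs} → (∀ {x} → x ∈ xs → ¬ P x) → length (filter P? xs) ≡ 0
  none-counted⁻ none = cong length (filter-none P? (All.tabulate none))

  one-counted : ∀ {xs} → length (filter P? xs) ≡ 1 →
                ∃[ x ] x ∈ xs × P x × (∀ {y} → y ∈ xs → P y → y ≡ x)
  one-counted {xs} c≡1 with filter P? xs in eq
  one-counted {xs} refl | x ∷ [] = x , proj₁ x∈xs×px , proj₂ x∈xs×px , only
    where
    x∈xs×px : x ∈ xs × P x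
    x∈xs×px = ∈-filter⁻ P? {xs = xs} (subst (x ∈_) (sym eq) (here refl))

    only : ∀ {y} → y ∈ xs → P y → y ≡ x
    only y∈xs py with subst (_ ∈_) eq (∈-filter⁺ P? y∈xs py)
    ... | here y≡x = y≡x

  private
    unique-singleton : ∀ {L : List A} {x} → Unique L → x ∈ L → (∀ {y} → y ∈ L → y ≡ x) →
                       length L ≡ 1
    unique-singleton {_ ∷ []}    _               _ _    = refl
    unique-singleton {z ∷ w ∷ L} ((z≢w ∷ _) ∷ _) _ only =
      contradiction (trans (only (here refl)) (sym (only (there (here refl))))) z≢w

  one-counted⁻ : ∀ {xs x} → Unique xs → x ∈ xs → P x → (∀ {y} → y ∈ xs → P y → y ≡ x) →
                 length (filter P? xs) ≡ 1
  one-counted⁻ uniq x∈xs px only =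
    unique-singleton (filter⁺ P? uniq) (∈-filter⁺ P? x∈xs px)
                     (λ y∈ → let (y∈xs , py) = ∈-filter⁻ P? y∈ in only y∈xs py)

Incident : ∀ {n} (G : LGraph n) → Fin (m G) → Fin (k G) → Parity → Set
Incident G v e p = endpoint p (ends G e) ≡ v

UniqueIncidence : ∀ {n} (G : LGraph n) → Fin (m G) → Set
UniqueIncidence G v =
  ∃[ e ] ∃[ p ] Incident G v e p × (∀ e′ p′ → Incident G v e′ p′ → e′ ≡ e × p′ ≡ p)

module _ {n : ℕ} (G : LGraph n) (v : Fin (m G)) where

  private
    incidences-at : Parity → List (Fin (k G))
    incidences-at p = filter (λ e → endpoint p (ends G e) ≟ v) (allFin (k G))

    module C (p : Parity) = Counting (λ e → endpoint p (ends G e) ≟ v)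

    unique-from-counts : ∀ p → length (incidences-at p) ≡ 1 →
                         length (incidences-at (p ⁻¹)) ≡ 0 → UniqueIncidence G v
    unique-from-counts p one none with C.one-counted p one
    ... | e , _ , inc , only = e , p , inc , unique
      where
      unique : ∀ e′ p′ → Incident G v e′ p′ → e′ ≡ e × p′ ≡ p
      unique e′ p′ inc′ with p′ ≟ℙ p
      ... | yes refl = only (∈-allFin e′) inc′ , refl
      ... | no  p′≢p = contradiction (subst (λ q → Incident G v e′ q) (≢⇒opposite p′≢p) inc′)
                                     (C.none-counted (p ⁻¹) none (∈-allFin e′))

  -- The degree is the sum of the two counts; a count ≥ 2 is impossible.
  leaf⇒unique-incidence : IsLeaf G v → UniqueIncidence G v
  leaf⇒unique-incidence deg≡1 with length (incidences-at 0ℙ) in eq₀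
  ... | 0 = unique-from-counts 1ℙ deg≡1 eq₀
  ... | 1 = unique-from-counts 0ℙ eq₀ (suc-injective deg≡1)

  unique-incidence⇒leaf : UniqueIncidence G v → IsLeaf G v
  unique-incidence⇒leaf (e , p , inc , unique) = degree-from p one none
    where
    one : length (incidences-at p) ≡ 1
    one = C.one-counted⁻ p (allFin⁺ (k G)) (∈-allFin e) inc (λ _ inc′ → proj₁ (unique _ p inc′))
    none : length (incidences-at (p ⁻¹)) ≡ 0
    none = C.none-counted⁻ (p ⁻¹) {allFin (k G)}
             (λ _ inc′ → p≢p⁻¹ p (sym (proj₂ (unique _ (p ⁻¹) inc′))))
    degree-from : ∀ p → length (incidences-at p) ≡ 1 → length (incidences-at (p ⁻¹)) ≡ 0 →
                  degree G v ≡ 1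
    degree-from 0ℙ one none = cong₂ _+ℕ_ one none
    degree-from 1ℙ one none = cong₂ _+ℕ_ none one

module Contraction {n : ℕ} (T : LGraph n) (F : Subset (k T)) (T′ : LGraph n)
  (h : Fin (m T) → Fin (m T′)) (κ : Fin (k T′) → Fin (k T))
  (h-fibres : ∀ u v → (h u ≡ h v) ⇔ ReachWithin T F u v)
  (κ-injective : Injective _≡_ _≡_ κ)
  (κ-image : ∀ e → e ∉ₛ F ⇔ (∃[ j ] κ j ≡ e))
  (κ-ends : ∀ j → Step T′ j (h (proj₁ (ends T (κ j)))) (h (proj₂ (ends T (κ j)))))
  where

  open Walks T
  private module W′ = Walks T′

  κ∉F : ∀ j → κ j ∉ₛ F
  κ∉F j = Equivalence.from (κ-image (κ j)) (j , refl)

  edge-kinds : ∀ e → e ∈ₛ F ⊎ ∃[ j ] κ j ≡ e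
  edge-kinds e with e ∈ₛ? F
  ... | yes e∈F = inj₁ e∈F
  ... | no  e∉F = inj₂ (Equivalence.to (κ-image e) e∉F)

  F-step : ∀ {e u w} → e ∈ₛ F → Step T e u w → h u ≡ h w
  F-step e∈F s = Equivalence.from (h-fibres _ _) (cons _ s nil , e∈F ∷ [])

  image-step : ∀ j p → Step T′ j (h (endpoint p (ends T (κ j)))) (h (endpoint (p ⁻¹) (ends T (κ j))))
  image-step j 0ℙ = κ-ends j
  image-step j 1ℙ = W′.step-sym (κ-ends j)

  project-step : ∀ {j u w} → Step T (κ j) u w → Step T′ j (h u) (h w)
  project-step {j} s with step-endpoints s
  ... | p , refl , refl = image-step j p

  lift-step : ∀ {j u′ w′} → Step T′ j u′ w′ →
              ∃[ p ] h (endpoint p (ends T (κ j))) ≡ u′ × h (endpoint (p ⁻¹) (ends T (κ j))) ≡ w′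
  lift-step {j} s′ with κ-ends j | s′
  ... | inj₁ eq | inj₁ eq′ = 0ℙ , ,-injective (trans (sym eq) eq′)
  ... | inj₁ eq | inj₂ eq′ = 1ℙ , swap (,-injective (trans (sym eq) eq′))
  ... | inj₂ eq | inj₁ eq′ = 1ℙ , ,-injective (trans (sym eq) eq′)
  ... | inj₂ eq | inj₂ eq′ = 0ℙ , swap (,-injective (trans (sym eq) eq′))

  project : ∀ {u v} → Walk T u v → Walk T′ (h u) (h v)
  project nil = nil
  project {v = v} (cons e s W) with edge-kinds e
  ... | inj₁ e∈F     = subst (λ x → Walk T′ x (h v)) (sym (F-step e∈F s)) (project W)
  ... | inj₂ (j , refl) = cons j (project-step s) (project W)

  outside : Fin (k T) → Parity
  outside e = if does (e ∈ₛ? F) then 0ℙ else 1ℙ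

  outside-κ : ∀ j → outside (κ j) ≡ 1ℙ
  outside-κ j = cong (if_then 0ℙ else 1ℙ) (dec-false (κ j ∈ₛ? F) (κ∉F j))

  outside-F : ∀ {L} → All (_∈ₛ F) L → weight outside L ≡ 0ℙ
  outside-F []           = refl
  outside-F {e ∷ _} (e∈F ∷ in-F) =
    cong₂ _+_ (cong (if_then 0ℙ else 1ℙ) (dec-true (e ∈ₛ? F) e∈F)) (outside-F in-F)

  InFOrOn : ∀ {u′ v′} → Walk T′ u′ v′ → Fin (k T) → Set
  InFOrOn W′ e = e ∈ₛ F ⊎ ∃[ j ] j ∈ wedges T′ W′ × κ j ≡ e

  record Lift {u′ v′} (W′ : Walk T′ u′ v′) (u v : Fin (m T)) : Set where
    field
      walk           : Walk T u v
      edges          : All (InFOrOn W′) (wedges T walk)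
      outside-parity : weight outside (wedges T walk) ≡ parity (wlength T′ W′)

  -- Every walk of T′ lifts between any two preimages of its ends: join the
  -- lifts of its edges by walks inside the fibres of h, which use only F.
  lift : ∀ {u′ v′} (W′ : Walk T′ u′ v′) {u v} → h u ≡ u′ → h v ≡ v′ → Lift W′ u v
  lift nil {u} {v} refl hv≡ with Equivalence.to (h-fibres u v) (sym hv≡)
  ... | W , in-F = record { walk = W ; edges = All.map inj₁ in-F ; outside-parity = outside-F in-F }
  lift (cons j s′ W′) {u} {v} refl hv≡ with lift-step s′
  ... | p , ha≡ , hb≡ with Equivalence.to (h-fibres u _) (sym ha≡) | lift W′ hb≡ hv≡
  ...   | Wᶠ , in-F | record { walk = R ; edges = R-edges ; outside-parity = R-parity } = record
    { walk  = Wᶠ ++w cons (κ j) (step-from p (κ j)) R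
    ; edges = subst (All _) (sym (wedges-++w Wᶠ _))
                (AllP.++⁺ (All.map inj₁ in-F)
                          (inj₂ (j , here refl , refl) ∷ All.map later R-edges))
    ; outside-parity = begin
        weight outside (wedges T (Wᶠ ++w cons (κ j) _ R))
          ≡⟨ cong (weight outside) (wedges-++w Wᶠ _) ⟩
        weight outside (wedges T Wᶠ ++ κ j ∷ wedges T R)
          ≡⟨ weight-++ outside (wedges T Wᶠ) _ ⟩
        weight outside (wedges T Wᶠ) + (outside (κ j) + weight outside (wedges T R))
          ≡⟨ cong₂ (λ a b → a + (b + weight outside (wedges T R))) (outside-F in-F) (outside-κ j) ⟩
        1ℙ + weight outside (wedges T R)
          ≡⟨ cong (1ℙ +_) R-parity ⟩
        1ℙ + parity (wlength T′ W′)
          ≡⟨ sym (+-homo-+ 1 (wlength T′ W′)) ⟩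
        parity (wlength T′ (cons j s′ W′)) ∎
    }
    where
    later : ∀ {e} → InFOrOn W′ e → InFOrOn (cons j s′ W′) e
    later (inj₁ e∈F)             = inj₁ e∈F
    later (inj₂ (j′ , j′∈ , eq)) = inj₂ (j′ , there j′∈ , eq)

  connected′ : Surjective _≡_ _≡_ h → Connected T → Connected T′
  connected′ h-onto connected u′ v′ =
    subst₂ (Walk T′) (proj₂ (h-onto u′) refl) (proj₂ (h-onto v′) refl)
           (project (connected (proj₁ (h-onto u′)) (proj₁ (h-onto v′))))

  -- Contracting edges of an acyclic graph keeps it acyclic: the rest of a cycle
  -- through j₀ would lift to a walk joining the ends of κ j₀ and avoiding κ j₀.
  acyclic′ : Acyclic T → Acyclic T′
  acyclic′ acyclic u′ nil (() , _)
  acyclic′ acyclic u′ (cons j₀ s′ rest) (_ , (j₀∉rest ∷ _) , _) with lift-step s′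
  ... | p , ha≡ , hb≡ with lift rest hb≡ ha≡
  ...   | record { walk = W ; edges = W-edges } =
    no-return acyclic (step-from p (κ j₀)) (reach-sym (W , All.map avoids-κj₀ W-edges))
    where
    avoids-κj₀ : ∀ {e} → InFOrOn rest e → e ≢ κ j₀
    avoids-κj₀ (inj₁ e∈F)                 refl   = κ∉F j₀ e∈F
    avoids-κj₀ (inj₂ (j , j∈rest , refl)) κj≡κj₀ =
      All.lookup j₀∉rest j∈rest (sym (κ-injective κj≡κj₀))

  project-incidence : ∀ {u} j p → Incident T u (κ j) p → ∃[ q ] Incident T′ (h u) j q
  project-incidence j p refl with W′.step-endpoints (image-step j p)
  ... | q , inc , _ = q , inc

  lift-incidence : ∀ {v′} j q → Incident T′ v′ j q → ∃[ p ] h (endpoint p (ends T (κ j))) ≡ v′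
  lift-incidence j q inc with W′.endpoint-of-step (image-step j 0ℙ) q
  ... | inj₁ eq = 0ℙ , trans (sym eq) inc
  ... | inj₂ eq = 1ℙ , trans (sym eq) inc

inside-and-outside : ∀ {n} (π : Partition n) i → ∃[ z ] ∃[ y ] part π z ≡ i × part π y ≢ i
inside-and-outside π i =
  proj₁ (nonempty π i) , proj₁ (nonempty π i′)
  , proj₂ (nonempty π i) refl , i′≢i ∘ trans (sym (proj₂ (nonempty π i′) refl))
  where
  another : ∀ {t} → 2 ≤ t → (i : Fin t) → ∃[ i′ ] i′ ≢ i
  another (s≤s (s≤s _)) zero    = suc zero , λ ()
  another (s≤s (s≤s _)) (suc _) = zero , λ ()

  i′ = proj₁ (another (2≤t π) i)
  i′≢i = proj₂ (another (2≤t π) i)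

module DisplayContraction {n : ℕ} (T : LGraph n) (tree : IsTree T) (π : Partition n)
  (F : Subset (k T)) (ξ : Fin (t π) → Fin (k T)) (ξ-injective : Injective _≡_ _≡_ ξ)
  (ξ-image : ∀ e → e ∈ₛ F ⇔ (∃[ i ] ξ i ≡ e))
  (split : ∀ i → SplitIs T (ξ i) (Part π i))
  (T′ : LGraph n) (h : Fin (m T) → Fin (m T′)) (κ : Fin (k T′) → Fin (k T))
  (h-fibres : ∀ u v → (h u ≡ h v) ⇔ ReachWithin T F u v)
  (κ-injective : Injective _≡_ _≡_ κ)
  (κ-image : ∀ e → e ∉ₛ F ⇔ (∃[ j ] κ j ≡ e))
  (κ-ends : ∀ j → Step T′ j (h (proj₁ (ends T (κ j)))) (h (proj₂ (ends T (κ j)))))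
  (φ-h : ∀ x → φ T′ x ≡ h (φ T x))
  where

  open Walks T
  open Contraction T F T′ h κ h-fibres κ-injective κ-image κ-ends public

  -- Since F is the image of the injection ξ, the weight of an edge outside F
  -- is 1ℙ plus the number of i with ξ i equal to it.
  outside-via-ξ : ∀ e → outside e ≡ 1ℙ + ∑[ i < t π ] δ (ξ i) e
  outside-via-ξ e with e ∈ₛ? F
  ... | yes e∈F = sym (cong (1ℙ +_) (∑δ-image ξ-injective (Equivalence.to (ξ-image e) e∈F)))
  ... | no  e∉F = sym (cong (1ℙ +_) (∑δ-outside (e∉F ∘ Equivalence.from (ξ-image e))))

  -- Every label lies in exactly one part, so summing the crossing numbers of
  -- all edges of F along a walk between two labels gives 1ℙ + 1ℙ = 0ℙ.
  labels-cancel : ∀ x y → ∑[ i < t π ] (δ i (part π x) + δ i (part π y)) ≡ 0ℙ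
  labels-cancel x y =
    trans (∑-distrib-+ (λ i → δ i (part π x)) (λ i → δ i (part π y)))
          (cong₂ _+_ (∑δ-image id (part π x , refl)) (∑δ-image id (part π y , refl)))

  crosses-split-edge : ∀ i {z y} → part π z ≡ i → part π y ≢ i →
                       (W : Walk T (φ T z) (φ T y)) → ξ i ∈ wedges T W
  crosses-split-edge i z-in y-out W = odd-crossings⇒∈ (ξ i) _ (begin
    crossings (ξ i) (wedges T W)         ≡⟨ split-crossings T tree π (split i) W ⟩
    δ i (part π _) + δ i (part π _)      ≡⟨ cong₂ _+_ (trans (cong (δ i) z-in) (δ-same i))
                                                       (δ-diff (y-out ∘ sym)) ⟩
    1ℙ ∎)

  -- T / F is even: lift a path of T / F between two labels to a walk W of T.
  -- The edges of W outside F have the parity of the path; all edges of W have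
  -- the parity of the (even) path of T between the labels, and the edges of W
  -- in F have parity 0ℙ by labels-cancel.
  even′ : (∀ x y (P : Walk T (φ T x) (φ T y)) → IsPath T P → 2 ∣ wlength T P) →
          ∀ x y (P′ : Walk T′ (φ T′ x) (φ T′ y)) → IsPath T′ P′ → 2 ∣ wlength T′ P′
  even′ even x y P′ _ = parity≡0ℙ⇒even _ (begin
    parity (wlength T′ P′)
      ≡⟨ sym (Lift.outside-parity lifted) ⟩
    weight outside L
      ≡⟨ weight-cong outside-via-ξ L ⟩
    weight (λ e → 1ℙ + ∑[ i < t π ] δ (ξ i) e) L
      ≡⟨ weight-+ (λ _ → 1ℙ) (λ e → ∑[ i < t π ] δ (ξ i) e) L ⟩
    weight (λ _ → 1ℙ) L + weight (λ e → ∑[ i < t π ] δ (ξ i) e) L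
      ≡⟨ cong₂ _+_ (weight-ones L) (weight-∑ (λ i → δ (ξ i)) L) ⟩
    parity (wlength T W) + ∑[ i < t π ] crossings (ξ i) L
      ≡⟨ cong₂ _+_ (length-parity-invariant T tree W P)
                   (sum-cong-≗ (λ i → split-crossings T tree π (split i) W)) ⟩
    parity (wlength T P) + ∑[ i < t π ] (δ i (part π x) + δ i (part π y))
      ≡⟨ cong₂ _+_ (even⇒parity≡0ℙ (even x y P P-path)) (labels-cancel x y) ⟩
    0ℙ ∎)
    where
    lifted = lift P′ (sym (φ-h x)) (sym (φ-h y))
    W = Lift.walk lifted
    L = wedges T W
    P = proj₁ (shortcut W)
    P-path = proj₁ (proj₂ (shortcut W))

  -- Let v′ be an unlabelled leaf whose unique
  -- incidence is with j₀, and let a be an end of f = κ j₀ with h a = v′.  The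
  -- side of f at a maps to v′, so all labels lie on the other side.  An edge
  -- ξ i of F at a would have both ends on the side of a, yet a walk between a
  -- label in part i and one in another part traverses ξ i.  So no edge of F
  -- meets a, f is the only edge at a, and a is a leaf of T, hence labelled.
  module UnlabelledLeaf (leaf-labelled : ∀ v → IsLeaf T v → ∃[ x ] φ T x ≡ v)
    (v′ : Fin (m T′)) (unlabelled : ¬ (∃[ x ] φ T′ x ≡ v′))
    (j₀ : Fin (k T′)) (q₀ : Parity) (inc₀ : Incident T′ v′ j₀ q₀)
    (only-j₀ : ∀ j q → Incident T′ v′ j q → j ≡ j₀ × q ≡ q₀)
    where

    f = κ j₀
    p = proj₁ (lift-incidence j₀ q₀ inc₀)
    a = endpoint p (ends T f)

    ha≡v′ : h a ≡ v′
    ha≡v′ = proj₂ (lift-incidence j₀ q₀ inc₀)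

    open Sides T (proj₂ tree) f

    -- Only j₀ leaves the fibre of v′, so walks avoiding f stay inside it.
    stays-in-fibre : ∀ {u w} → h u ≡ v′ → (W : Walk T u w) → All (_≢ f) (wedges T W) →
                     h w ≡ v′
    stays-in-fibre hu≡v′ nil _ = hu≡v′
    stays-in-fibre hu≡v′ (cons e s W) (e≢f ∷ avoids) with edge-kinds e
    ... | inj₁ e∈F = stays-in-fibre (trans (sym (F-step e∈F s)) hu≡v′) W avoids
    ... | inj₂ (j , refl) with step-endpoints s
    ...   | p′ , inc , _ with project-incidence j p′ inc
    ...     | q , inc′ = contradiction (cong κ (proj₁ (only-j₀ j q (trans inc′ hu≡v′)))) e≢f

    labels-far : ∀ x → OnSide (p ⁻¹) (φ T x)
    labels-far x with side-of (proj₁ tree) (φ T x)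
    ... | r , on-r with r ≟ℙ p
    ...   | yes refl = let (W , avoids) = OnSide.reach on-r
                       in contradiction (x , trans (φ-h x) (stays-in-fibre ha≡v′ W avoids)) unlabelled
    ...   | no  r≢p  = subst (λ q → OnSide q _) (≢⇒opposite r≢p) on-r

    labels-joined : ∀ z y → ReachAvoiding T f (φ T z) (φ T y)
    labels-joined z y =
      reach-trans (reach-sym (OnSide.reach (labels-far z))) (OnSide.reach (labels-far y))

    -- No edge of F meets a: such an edge ξ i lies on the side of a, but a
    -- walk avoiding f between labels in and outside part i reaches it.
    no-F-edge-at-a : ∀ {e q} → e ∈ₛ F → ¬ Incident T a e q
    no-F-edge-at-a {e} {q} e∈F inc with Equivalence.to (ξ-image e) e∈F
    ... | i , refl with inside-and-outside π i
    ...   | z , y , z-in , y-out with labels-joined z y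
    ...     | W , W-avoids with reach-endpoint W (crosses-split-edge i z-in y-out W)
    ...       | r , V , V⊆W = p≢p⁻¹ p (sym (sides-disjoint far near))
      where
      far : OnSide (p ⁻¹) (endpoint r (ends T (ξ i)))
      far = on-side (reach-trans (OnSide.reach (labels-far z)) (V , AllP.anti-mono V⊆W W-avoids))

      ξi≢f : ξ i ≢ f
      ξi≢f ξi≡f = κ∉F j₀ (subst (_∈ₛ F) ξi≡f e∈F)

      near : OnSide p (endpoint r (ends T (ξ i)))
      near = edge-within-side {q = q} ξi≢f (subst (OnSide p) (sym inc) (own-side p)) r

    a-is-leaf : IsLeaf T a
    a-is-leaf = unique-incidence⇒leaf T a (f , p , refl , only-f)
      where
      only-f : ∀ e q → Incident T a e q → e ≡ f × q ≡ p
      only-f e q inc with edge-kinds e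
      ... | inj₁ e∈F = contradiction inc (no-F-edge-at-a {e} {q} e∈F)
      ... | inj₂ (j , refl) with project-incidence j q inc
      ...   | q′ , inc′ with only-j₀ j q′ (trans inc′ ha≡v′) | q ≟ℙ p
      ...     | refl , _ | yes q≡p = refl , q≡p
      ...     | refl , _ | no  q≢p =
        contradiction (sides-disjoint (subst (OnSide q) inc (own-side q)) (own-side p)) q≢p

    labelled : ∃[ x ] φ T′ x ≡ v′
    labelled with leaf-labelled a a-is-leaf
    ... | x , φx≡a = x , trans (φ-h x) (trans (cong h φx≡a) ha≡v′)

  leaf′ : (∀ v → IsLeaf T v → ∃[ x ] φ T x ≡ v) → ∀ v′ → IsLeaf T′ v′ → ∃[ x ] φ T′ x ≡ v′
  leaf′ leaf-labelled v′ is-leaf with any? (λ x → φ T′ x ≟ v′)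
  ... | yes labelled = labelled
  ... | no  unlabelled with leaf⇒unique-incidence T′ v′ is-leaf
  ...   | j₀ , q₀ , inc₀ , only-j₀ =
    UnlabelledLeaf.labelled leaf-labelled v′ unlabelled j₀ q₀ inc₀ only-j₀

lemma4p3 : (n : ℕ) → 2 ≤ n → (T : LGraph n) → IsEvenXTree T
    → (π : Partition n) → DisplaysPartition T π
    → (F : Subset (k T)) → Displays T π F
    → (T' : LGraph n) → IsContraction T F T'
    → IsEvenXTree T'
lemma4p3 n _ T ((tree , leaf-labelled) , even) π _ F (ξ , ξ-injective , ξ-image , split)
         T′ (h , κ , h-onto , h-fibres , κ-injective , κ-image , κ-ends , φ-h) =
  ((connected′ h-onto (proj₁ tree) , acyclic′ (proj₂ tree)) , leaf′ leaf-labelled) , even′ even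
  where
  open DisplayContraction T tree π F ξ ξ-injective ξ-image split
                          T′ h κ h-fibres κ-injective κ-image κ-ends φ-h
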